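{- Let $M=(m_{ij})\in\mathbb{Z}^{d\times d}$ satisfy $m_{ii}=0$, $m_{ij}+m_{jk}\ge m_{ik}$ for all $i,j,k$, $M\ge0$, and $m_{ij}+m_{ji}>0$ for $i\ne j$. Let $N=(n_{ij})\in\mathbb{Z}^{d\times d}$ satisfy $n_{ik}\le n_{ij}+m_{jk}$ and $n_{ik}\le m_{ij}+n_{jk}$ for all $i,j,k$. Then $$(\Lambda_M:I_N)=\{X\in K^{d\times d}: XI_N\subseteq\Lambda_M\text{ and } I_NX\subseteq\Lambda_M\}$$ equals $I_{N'}$, where $N'=(n'_{ij})$ is given by $$n'_{ij}=\max_{1\le\ell\le d}\ \max\big(m_{\ell j}-n_{\ell i},\ m_{i\ell}-n_{j\ell}\big)\qquad(1\le i,j\le d).$$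
   Context: $K$ is a field with a surjective discrete valuation $\mathrm{val}:K\to\mathbb{Z}\cup\{\infty\}$, $p\in K$ with $\mathrm{val}(p)=1$, $\mathcal{O}_K$ its valuation ring. For an integer matrix $A=(a_{ij})$, $I_A=\{X\in K^{d\times d}:\mathrm{val}(x_{ij})\ge a_{ij}\ \forall i,j\}$, and $\Lambda_M=I_M$. -}

module Defs where

open import Level using (Level; _⊔_; suc)
open import Data.Nat using (ℕ)
open import Data.Integer as ℤ using (ℤ; +_)
open import Data.Fin using (Fin)
open import Data.Product using (∃)
open import Data.Vec.Functional using (foldr)
open import Relation.Nullary using (¬_)
open import Relation.Binary.PropositionalEquality using (_≡_)
open import Algebra.Bundles using (CommutativeRing)

data ℤ∞ : Set where
  fin : ℤ → ℤ∞
  ∞   : ℤ∞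

infix 4 _≤∞_
data _≤∞_ : ℤ∞ → ℤ∞ → Set where
  fin≤fin : ∀ {a b} → a ℤ.≤ b → fin a ≤∞ fin b
  _≤∞∞    : ∀ x → x ≤∞ ∞

infixl 6 _+∞_
_+∞_ : ℤ∞ → ℤ∞ → ℤ∞
fin a +∞ fin b = fin (a ℤ.+ b)
fin a +∞ ∞     = ∞
∞     +∞ _     = ∞

min∞ : ℤ∞ → ℤ∞ → ℤ∞
min∞ (fin a) (fin b) = fin (a ℤ.⊓ b)
min∞ (fin a) ∞       = fin a
min∞ ∞       y       = y

record Field (c ℓ : Level) : Set (suc (c ⊔ ℓ)) where
  field
    commutativeRing : CommutativeRing c ℓ
  open CommutativeRing commutativeRing public
  field
    0≉1     : ¬ (0# ≈ 1#)
    inverse : ∀ x → ¬ (x ≈ 0#) → ∃ λ y → x * y ≈ 1#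

record DiscreteValuation {c ℓ : Level} (K : Field c ℓ) : Set (c ⊔ ℓ) where
  open Field K
  field
    val      : Carrier → ℤ∞
    val-cong : ∀ {x y} → x ≈ y → val x ≡ val y
    val-∞→0  : ∀ x → val x ≡ ∞ → x ≈ 0#
    val-0    : val 0# ≡ ∞
    val-*    : ∀ x y → val (x * y) ≡ val x +∞ val y
    val-+    : ∀ x y → min∞ (val x) (val y) ≤∞ val (x + y)
    val-surj : ∀ (z : ℤ) → ∃ λ x → val x ≡ fin z

Mat : ∀ {a} → Set a → ℕ → Set a
Mat A d = Fin d → Fin d → A

module _ {c ℓ : Level} {K : Field c ℓ} (v : DiscreteValuation K) where
  open Field K
  open DiscreteValuation v

  _·_ : ∀ {d} → Mat Carrier d → Mat Carrier d → Mat Carrier d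
  (X · Y) i j = foldr _+_ 0# (λ k → X i k * Y k j)

  I : ∀ {d} → Mat ℤ d → Mat Carrier d → Set
  I A X = ∀ i j → fin (A i j) ≤∞ val (X i j)

  Λ : ∀ {d} → Mat ℤ d → Mat Carrier d → Set
  Λ = I

  Colon : ∀ {d} → Mat ℤ d → Mat ℤ d → Mat Carrier d → Set c
  Colon M N X = ∀ Y → I N Y → Λ M (X · Y) × Λ M (Y · X)
    where open import Data.Product using (_×_)

-- maximum of f over all of Fin n (n ≥ 1, witnessed by an element k; f k is
-- used as the seed of the fold, which does not change the maximum)
maxFin : ∀ {n} → Fin n → (Fin n → ℤ) → ℤ
maxFin k f = foldr ℤ._⊔_ (f k) f

N′ : ∀ {d} → Mat ℤ d → Mat ℤ d → Mat ℤ d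
N′ M N i j = maxFin i (λ l → (M l j ℤ.- N l i) ℤ.⊔ (M i l ℤ.- N j l))

{-# OPTIONS --safe #-}
module Submission where

-- The inclusion I_{N′} ⊆ (Λ_M : I_N) is the ultrametric inequality: an entry of X·Y is a sum of
-- products x_ij y_jk of valuation ≥ n′_ij + n_jk, and n′_ij ≥ m_ik − n_jk by the choice ℓ = k in
-- the maximum (symmetrically for Y·X). Conversely, multiply X by the matrix unit a·E_ℓi with
-- val a = n_ℓi, which lies in I_N: entry (ℓ, j) of the product is a·x_ij, so m_ℓj ≤ n_ℓi + val x_ij;
-- the unit a·E_jℓ on the right gives m_iℓ ≤ val x_ij + n_jℓ. Taking the maximum over ℓ gives
-- val x_ij ≥ n′_ij. None of the hypotheses on M and N is needed.

open import Defs
open import Data.Nat using (ℕ)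
open import Data.Integer using (ℤ; +_; _+_; _-_; -_; _⊔_; _≤_; _<_)
open import Data.Integer.Properties
  using (+-0-abelianGroup; +-comm; +-monoˡ-≤; +-mono-≤; ≤-refl; ≤-trans; ⊔-lub; ⊓-glb; i≤i⊔j; i≤j⊔i; module ≤-Reasoning)
open import Data.Fin using (Fin; zero; suc; _≟_)
open import Data.Fin.Properties using (suc-injective)
open import Data.Product using (_×_; _,_; proj₁; proj₂)
open import Data.Vec.Functional using (foldr)
open import Data.Empty using (⊥-elim)
open import Relation.Nullary using (yes; no)
open import Relation.Binary.PropositionalEquality using (_≡_; _≢_; refl; sym; cong; subst)
open import Algebra.Bundles using (AbelianGroup; Monoid)
open import Algebra.Properties.Group (AbelianGroup.group +-0-abelianGroup) using (//-rightDividesˡ; //-rightDividesʳ)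

i-j≤k⇒i≤j+k : ∀ {i j k} → i - j ≤ k → i ≤ j + k
i-j≤k⇒i≤j+k {i} {j} {k} i-j≤k = begin
  i         ≡⟨ //-rightDividesˡ j i ⟨
  i - j + j ≤⟨ +-monoˡ-≤ j i-j≤k ⟩
  k + j     ≡⟨ +-comm k j ⟩
  j + k     ∎
  where open ≤-Reasoning

i≤j+k⇒i-j≤k : ∀ {i j k} → i ≤ j + k → i - j ≤ k
i≤j+k⇒i-j≤k {i} {j} {k} i≤j+k = begin
  i - j     ≤⟨ +-monoˡ-≤ (- j) i≤j+k ⟩
  j + k - j ≡⟨ cong (_- j) (+-comm j k) ⟩
  k + j - j ≡⟨ //-rightDividesʳ j k ⟩
  k         ∎
  where open ≤-Reasoning

foldr-⊔-lub : ∀ {n} (f : Fin n → ℤ) {s c} → s ≤ c → (∀ l → f l ≤ c) → foldr _⊔_ s f ≤ c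
foldr-⊔-lub {ℕ.zero}  f s≤c f≤c = s≤c
foldr-⊔-lub {ℕ.suc n} f s≤c f≤c = ⊔-lub (f≤c zero) (foldr-⊔-lub (λ l → f (suc l)) s≤c (λ l → f≤c (suc l)))

foldr-⊔-ub : ∀ {n} (f : Fin n → ℤ) s l → f l ≤ foldr _⊔_ s f
foldr-⊔-ub f s zero    = i≤i⊔j _ _
foldr-⊔-ub f s (suc l) = ≤-trans (foldr-⊔-ub (λ l → f (suc l)) s l) (i≤j⊔i _ _)

maxFin-lub : ∀ {n} (k : Fin n) (f : Fin n → ℤ) {c} → (∀ l → f l ≤ c) → maxFin k f ≤ c
maxFin-lub k f f≤c = foldr-⊔-lub f (f≤c k) f≤c

maxFin-ub : ∀ {n} (k : Fin n) (f : Fin n → ℤ) l → f l ≤ maxFin k f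
maxFin-ub k f = foldr-⊔-ub f (f k)

≤∞-trans : ∀ {x y z} → x ≤∞ y → y ≤∞ z → x ≤∞ z
≤∞-trans (fin≤fin a≤b) (fin≤fin b≤c) = fin≤fin (≤-trans a≤b b≤c)
≤∞-trans _             (_ ≤∞∞)       = _ ≤∞∞

fin≤∞-weaken : ∀ {a b x} → b ≤ a → fin a ≤∞ x → fin b ≤∞ x
fin≤∞-weaken b≤a (fin≤fin a≤c) = fin≤fin (≤-trans b≤a a≤c)
fin≤∞-weaken b≤a (_ ≤∞∞)       = _ ≤∞∞

fin≤∞-min∞ : ∀ {c x y} → fin c ≤∞ x → fin c ≤∞ y → fin c ≤∞ min∞ x y
fin≤∞-min∞ (fin≤fin c≤a) (fin≤fin c≤b) = fin≤fin (⊓-glb c≤a c≤b)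
fin≤∞-min∞ (fin≤fin c≤a) (_ ≤∞∞)       = fin≤fin c≤a
fin≤∞-min∞ (_ ≤∞∞)       c≤y           = c≤y

fin≤∞-⊔ : ∀ {a b x} → fin a ≤∞ x → fin b ≤∞ x → fin (a ⊔ b) ≤∞ x
fin≤∞-⊔ (fin≤fin a≤c) (fin≤fin b≤c) = fin≤fin (⊔-lub a≤c b≤c)
fin≤∞-⊔ (_ ≤∞∞)       _             = _ ≤∞∞

fin≤∞-maxFin : ∀ {n} (k : Fin n) (f : Fin n → ℤ) {x} → (∀ l → fin (f l) ≤∞ x) → fin (maxFin k f) ≤∞ x
fin≤∞-maxFin k f {fin c} f≤c = fin≤fin (maxFin-lub k f λ l → unfin (f≤c l))
  where
  unfin : ∀ {a} → fin a ≤∞ fin c → a ≤ c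
  unfin (fin≤fin a≤c) = a≤c
fin≤∞-maxFin k f {∞}     _   = _ ≤∞∞

+∞-mono-≤∞ : ∀ {a b x y} → fin a ≤∞ x → fin b ≤∞ y → fin (a + b) ≤∞ x +∞ y
+∞-mono-≤∞ (fin≤fin a≤c) (fin≤fin b≤d) = fin≤fin (+-mono-≤ a≤c b≤d)
+∞-mono-≤∞ (fin≤fin _)   (_ ≤∞∞)       = _ ≤∞∞
+∞-mono-≤∞ (_ ≤∞∞)       _             = _ ≤∞∞

fin+∞-cancel-≤∞ : ∀ {m n x} → fin m ≤∞ fin n +∞ x → fin (m - n) ≤∞ x
fin+∞-cancel-≤∞ {x = fin _} (fin≤fin m≤n+c) = fin≤fin (i≤j+k⇒i-j≤k m≤n+c)
fin+∞-cancel-≤∞ {x = ∞}     _               = _ ≤∞∞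

module FiniteSums {c ℓ} (G : Monoid c ℓ) where
  open Monoid G renaming (refl to ≈-refl)
  open import Relation.Binary.Reasoning.Setoid setoid

  foldr-zero : ∀ {n} (f : Fin n → Carrier) → (∀ k → f k ≈ ε) → foldr _∙_ ε f ≈ ε
  foldr-zero {ℕ.zero}  f f≈ε = ≈-refl
  foldr-zero {ℕ.suc n} f f≈ε = begin
    f zero ∙ foldr _∙_ ε (λ k → f (suc k)) ≈⟨ ∙-cong (f≈ε zero) (foldr-zero (λ k → f (suc k)) (λ k → f≈ε (suc k))) ⟩
    ε ∙ ε                                  ≈⟨ identityˡ ε ⟩
    ε                                      ∎

  foldr-single : ∀ {n} (f : Fin n → Carrier) i → (∀ k → k ≢ i → f k ≈ ε) → foldr _∙_ ε f ≈ f i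
  foldr-single {ℕ.suc n} f zero f≈ε = begin
    f zero ∙ foldr _∙_ ε (λ k → f (suc k)) ≈⟨ ∙-congˡ (foldr-zero (λ k → f (suc k)) (λ k → f≈ε (suc k) λ ())) ⟩
    f zero ∙ ε                             ≈⟨ identityʳ (f zero) ⟩
    f zero                                 ∎
  foldr-single {ℕ.suc n} f (suc i) f≈ε = begin
    f zero ∙ foldr _∙_ ε (λ k → f (suc k)) ≈⟨ ∙-cong (f≈ε zero λ ()) (foldr-single (λ k → f (suc k)) i (λ k k≢i → f≈ε (suc k) λ e → k≢i (suc-injective e))) ⟩
    ε ∙ f (suc i)                          ≈⟨ identityˡ (f (suc i)) ⟩
    f (suc i)                              ∎

N′-ubˡ : ∀ {d} (M N : Mat ℤ d) i j l → M l j - N l i ≤ N′ M N i j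
N′-ubˡ M N i j l = ≤-trans (i≤i⊔j _ _) (maxFin-ub i (λ l → (M l j - N l i) ⊔ (M i l - N j l)) l)

N′-ubʳ : ∀ {d} (M N : Mat ℤ d) i j l → M i l - N j l ≤ N′ M N i j
N′-ubʳ M N i j l = ≤-trans (i≤j⊔i _ _) (maxFin-ub i (λ l → (M l j - N l i) ⊔ (M i l - N j l)) l)

module Valuation {c ℓ} (K : Field c ℓ) (v : DiscreteValuation K) where
  open Field K renaming (_+_ to _⊕_; _*_ to _⊛_) using (Carrier; _≈_; 0#; +-monoid; setoid; *-comm; zeroˡ; zeroʳ; trans)
  open DiscreteValuation v
  open FiniteSums +-monoid
  open import Relation.Binary.Reasoning.Setoid setoid

  fin≤∞-val-0# : ∀ a → fin a ≤∞ val 0#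
  fin≤∞-val-0# a = subst (fin a ≤∞_) (sym val-0) (_ ≤∞∞)

  fin≤∞-val-cong : ∀ {m x y} → x ≈ y → fin m ≤∞ val x → fin m ≤∞ val y
  fin≤∞-val-cong x≈y = subst (fin _ ≤∞_) (val-cong x≈y)

  fin≤∞-val-* : ∀ {a b} x y → fin a ≤∞ val x → fin b ≤∞ val y → fin (a + b) ≤∞ val (x ⊛ y)
  fin≤∞-val-* x y a≤x b≤y = subst (fin _ ≤∞_) (sym (val-* x y)) (+∞-mono-≤∞ a≤x b≤y)

  fin≤∞-val-foldr : ∀ {n} (f : Fin n → Carrier) {k} → (∀ i → fin k ≤∞ val (f i)) → fin k ≤∞ val (foldr _⊕_ 0# f)
  fin≤∞-val-foldr {ℕ.zero}  f k≤f = fin≤∞-val-0# _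
  fin≤∞-val-foldr {ℕ.suc n} f k≤f =
    ≤∞-trans (fin≤∞-min∞ (k≤f zero) (fin≤∞-val-foldr (λ i → f (suc i)) (λ i → k≤f (suc i)))) (val-+ _ _)

  fin≤∞-val-*-cancelˡ : ∀ {a m n} x → val a ≡ fin n → fin m ≤∞ val (a ⊛ x) → fin (m - n) ≤∞ val x
  fin≤∞-val-*-cancelˡ {a} x va m≤ax =
    fin+∞-cancel-≤∞ (subst (fin _ ≤∞_) (subst (λ t → val (a ⊛ x) ≡ t +∞ val x) va (val-* a x)) m≤ax)

  unit : ∀ {d} → Carrier → Fin d → Fin d → Mat Carrier d
  unit a r s i j with i ≟ r | j ≟ s
  ... | yes _ | yes _ = a
  ... | _     | _     = 0#

  unit-diag : ∀ {d} a (r s : Fin d) → unit a r s r s ≡ a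
  unit-diag a r s with r ≟ r | s ≟ s
  ... | yes _ | yes _  = refl
  ... | yes _ | no s≢s = ⊥-elim (s≢s refl)
  ... | no r≢r | _     = ⊥-elim (r≢r refl)

  unit-off-col : ∀ {d} a (r s i k : Fin d) → k ≢ s → unit a r s i k ≡ 0#
  unit-off-col a r s i k k≢s with i ≟ r | k ≟ s
  ... | yes _ | yes k≡s = ⊥-elim (k≢s k≡s)
  ... | yes _ | no _    = refl
  ... | no _  | _       = refl

  unit-off-row : ∀ {d} a (r s k j : Fin d) → k ≢ r → unit a r s k j ≡ 0#
  unit-off-row a r s k j k≢r with k ≟ r | j ≟ s
  ... | yes k≡r | _ = ⊥-elim (k≢r k≡r)
  ... | no _    | _ = refl

  unit∈I : ∀ {d} (N : Mat ℤ d) {a} r s → val a ≡ fin (N r s) → I v N (unit a r s)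
  unit∈I N r s va i j with i ≟ r | j ≟ s
  ... | yes refl | yes refl = subst (fin _ ≤∞_) (sym va) (fin≤fin ≤-refl)
  ... | yes _    | no _     = fin≤∞-val-0# _
  ... | no _     | _        = fin≤∞-val-0# _

  unit-·ˡ : ∀ {d} a (r s j : Fin d) X → _·_ v (unit a r s) X r j ≈ a ⊛ X s j
  unit-·ˡ a r s j X = begin
    foldr _⊕_ 0# (λ k → unit a r s r k ⊛ X k j) ≈⟨ foldr-single _ s off-col ⟩
    unit a r s r s ⊛ X s j                      ≡⟨ cong (_⊛ X s j) (unit-diag a r s) ⟩
    a ⊛ X s j                                   ∎
    where
    off-col : ∀ k → k ≢ s → unit a r s r k ⊛ X k j ≈ 0#
    off-col k k≢s rewrite unit-off-col a r s r k k≢s = zeroˡ (X k j)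

  unit-·ʳ : ∀ {d} a (r s i : Fin d) X → _·_ v X (unit a r s) i s ≈ X i r ⊛ a
  unit-·ʳ a r s i X = begin
    foldr _⊕_ 0# (λ k → X i k ⊛ unit a r s k s) ≈⟨ foldr-single _ r off-row ⟩
    X i r ⊛ unit a r s r s                      ≡⟨ cong (X i r ⊛_) (unit-diag a r s) ⟩
    X i r ⊛ a                                   ∎
    where
    off-row : ∀ k → k ≢ r → X i k ⊛ unit a r s k s ≈ 0#
    off-row k k≢r rewrite unit-off-row a r s k s k≢r = zeroʳ (X i k)

  module _ {d} (M N : Mat ℤ d) {X : Mat Carrier d} where

    Colon⇒lower-boundˡ : Colon v M N X → ∀ i j l → fin (M l j - N l i) ≤∞ val (X i j)
    Colon⇒lower-boundˡ X∈ i j l with val-surj (N l i)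
    ... | a , va = fin≤∞-val-*-cancelˡ (X i j) va
      (fin≤∞-val-cong (unit-·ˡ a l i j X) (proj₂ (X∈ (unit a l i) (unit∈I N l i va)) l j))

    Colon⇒lower-boundʳ : Colon v M N X → ∀ i j l → fin (M i l - N j l) ≤∞ val (X i j)
    Colon⇒lower-boundʳ X∈ i j l with val-surj (N j l)
    ... | a , va = fin≤∞-val-*-cancelˡ (X i j) va
      (fin≤∞-val-cong (trans (unit-·ʳ a j l i X) (*-comm (X i j) a)) (proj₁ (X∈ (unit a j l) (unit∈I N j l va)) i l))

    Colon⇒I-N′ : Colon v M N X → I v (N′ M N) X
    Colon⇒I-N′ X∈ i j = fin≤∞-maxFin i _ λ l →
      fin≤∞-⊔ (Colon⇒lower-boundˡ X∈ i j l) (Colon⇒lower-boundʳ X∈ i j l)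

    I-N′⇒Colon : I v (N′ M N) X → Colon v M N X
    I-N′⇒Colon X∈ Y Y∈ =
        (λ i k → fin≤∞-val-foldr _ λ j → fin≤∞-weaken (M≤N′+N i j k) (fin≤∞-val-* _ _ (X∈ i j) (Y∈ j k)))
      , (λ k j → fin≤∞-val-foldr _ λ i → fin≤∞-weaken (M≤N+N′ i j k) (fin≤∞-val-* _ _ (Y∈ k i) (X∈ i j)))
      where
      M≤N′+N : ∀ i j k → M i k ≤ N′ M N i j + N j k
      M≤N′+N i j k = subst (M i k ≤_) (+-comm (N j k) _) (i-j≤k⇒i≤j+k (N′-ubʳ M N i j k))

      M≤N+N′ : ∀ i j k → M k j ≤ N k i + N′ M N i j
      M≤N+N′ i j k = i-j≤k⇒i≤j+k (N′-ubˡ M N i j k)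

proposition5p9 : ∀ {c ℓ} (K : Field c ℓ) (v : DiscreteValuation K) (d : ℕ)
    (M N : Mat ℤ d) →
    (∀ i → M i i ≡ + 0) →
    (∀ i j k → M i k ≤ M i j + M j k) →
    (∀ i j → + 0 ≤ M i j) →
    (∀ i j → i ≢ j → + 0 < M i j + M j i) →
    (∀ i j k → N i k ≤ N i j + M j k) →
    (∀ i j k → N i k ≤ M i j + N j k) →
    ∀ (X : Mat (Field.Carrier K) d) →
    (Colon v M N X → I v (N′ M N) X) × (I v (N′ M N) X → Colon v M N X)
proposition5p9 K v d M N _ _ _ _ _ _ X = Colon⇒I-N′ M N , I-N′⇒Colon M N
  where open Valuation K v
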